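{- Let $d\ge1$, $\mathcal{R}=\mathrm{GF}(2)[x_1,x_1^{ -1},\ldots,x_d,x_d^{ -1}]$, and let $F\in\mathcal{R}$ with $\mathrm{height}(F)\le 1$. Let $a_n(F)$ be the number of ON cells at generation $n$ of the odd-rule cellular automaton with neighborhood $F$ started at generation $0$ with a single ON cell at the origin. Then the sequence $[a_n(F),\ n\ge 0]$ is the run length transform of the sequence $[a_0(F),a_1(F),a_3(F),a_7(F),\ldots,a_{2^k-1}(F),\ldots]$, i.e., for every $n\ge0$, $$a_n(F)=\prod_{i\in\mathcal{L}(n)} a_{2^i-1}(F).$$
   Context: Cells are points of $\mathbb{Z}^d$, cell $u$ identified with monomial $x^u=x_1^{u_1}\cdots x_d^{u_d}$; a finite state is the mod-2 sum in $\mathcal{R}$ of the monomials of its ON cells. The neighborhood of the origin is $F\in\mathcal{R}$ and the neighborhood of cell $w$ is $x^wF$. Odd-rule CA: cell $u$ is ON at generation $n+1$ iff an odd number of cells $w$ ON at generation $n$ have $x^u$ as a monomial of $x^wF$. The height $\mathrm{height}(P)$ of $P\in\mathcal{R}$ is the maximum of $|e_i|$ over all monomials $x_1^{e_1}\cdots x_d^{e_d}$ appearing in $P$. For an integer $n\ge0$, $\mathcal{L}(n)$ is the list of lengths of the maximal runs of 1s in the binary expansion of $n$ (e.g. $\mathcal{L}(55)=[2,3]$, $\mathcal{L}(0)$ is empty). The run length transform of a sequence $[S_n,n\ge0]$ is $[T_n,n\ge0]$ with $T_n=\prod_{i\in\mathcal{L}(n)}S_i$ (so $T_0=1$, the empty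 product). -}

module Defs where

open import Data.Bool using (Bool; true; false; if_then_else_)
open import Data.Nat using (ℕ; zero; suc; _⊔_; _%_; _/_; _≡ᵇ_; _^_; _∸_)
open import Data.Integer as ℤ using (ℤ; +_)
open import Data.List as L using (List; []; _∷_; _++_; length; filterᵇ; deduplicate; concatMap)
open import Data.Nat.ListAction using (product)
open import Data.Vec as V using (Vec; zipWith; replicate; toList)
open import Data.Vec.Properties using (≡-dec)
open import Relation.Nullary using (does; Dec)
open import Relation.Binary.PropositionalEquality using (_≡_)

-- Exponent vectors (cells of ℤ^d / monomials x^u of R).
Cell : ℕ → Set
Cell d = Vec ℤ d

_≟c_ : ∀ {d} (u v : Cell d) → Dec (u ≡ v)
_≟c_ = ≡-dec ℤ._≟_

-- An element of R = GF(2)[x₁^±1,…,x_d^±1] is represented by a finite list of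
-- monomials, read as their sum mod 2 (so a monomial occurring an even number
-- of times cancels).
Poly : ℕ → Set
Poly d = List (Cell d)

mult : ∀ {d} → Cell d → Poly d → ℕ
mult u [] = 0
mult u (v ∷ vs) = if does (u ≟c v) then suc (mult u vs) else mult u vs

monomials : ∀ {d} → Poly d → List (Cell d)
monomials P = filterᵇ (λ u → mult u P % 2 ≡ᵇ 1) (deduplicate _≟c_ P)

height : ∀ {d} → Poly d → ℕ
height P = L.foldr (λ e m → L.foldr (λ c k → ℤ.∣ c ∣ ⊔ k) 0 (toList e) ⊔ m) 0 (monomials P)

_⊕_ : ∀ {d} → Cell d → Cell d → Cell d
_⊕_ = zipWith ℤ._+_

origin : ∀ d → Cell d
origin d = replicate d (+ 0)

-- One step of the odd-rule CA with neighbourhood F: the set of ON cells at the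
-- next generation is the set of u such that an odd number of ON cells w have
-- x^u a monomial of x^w F.
step : ∀ {d} → Poly d → List (Cell d) → List (Cell d)
step F s = monomials (concatMap (λ w → L.map (λ f → w ⊕ f) (monomials F)) s)

generation : ∀ {d} → Poly d → ℕ → List (Cell d)
generation {d} F zero = origin d ∷ []
generation F (suc n) = step F (generation F n)

a : ∀ {d} → Poly d → ℕ → ℕ
a F n = length (generation F n)

-- binary digits of n, least significant first (fuel = n suffices)
bitsAux : ℕ → ℕ → List Bool
bitsAux zero n = []
bitsAux (suc f) zero = []
bitsAux (suc f) (suc n) = ((suc n % 2) ≡ᵇ 1) ∷ bitsAux f (suc n / 2)

bits : ℕ → List Bool
bits n = bitsAux n n

flush : ℕ → List ℕ
flush zero = []
flush (suc k) = suc k ∷ []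

runsAux : ℕ → List Bool → List ℕ
runsAux acc [] = flush acc
runsAux acc (true ∷ bs) = runsAux (suc acc) bs
runsAux acc (false ∷ bs) = flush acc ++ runsAux 0 bs

-- 𝓛(n): lengths of the maximal runs of 1s in the binary expansion of n
runLengths : ℕ → List ℕ
runLengths n = runsAux 0 (bits n)

runLengthTransform : (ℕ → ℕ) → ℕ → ℕ
runLengthTransform S n = product (L.map S (runLengths n))

module Submission where

-- In R a state is a polynomial and generation n is Fⁿ. In characteristic 2, P(x)² = P(x²), so
-- F^(2ʲm)(x) = F^m(x^(2ʲ)) and, with K = 2ᵏ − 1,
--   F^(K + 2ᵏ⁺¹m)(x) = F^K(x) · F^m(x^(2ᵏ⁺¹)).
-- Since height F ≤ 1, the monomials of F^K lie in the box [−K, K]^d and those of the second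
-- factor in 2ᵏ⁺¹ℤ^d; as 2K < 2ᵏ⁺¹, all products of a monomial of each factor are distinct and
-- nothing cancels, so a(K + 2ᵏ⁺¹m) = a(K) · a(m). Peeling off the binary digits of n from the
-- least significant end, each maximal run of i ones contributes a factor a(2ⁱ − 1).

open import Defs
open import Data.Bool using (Bool; true; false; T; if_then_else_)
open import Data.Unit using (tt)
open import Relation.Nullary.Decidable using (T?)
open import Data.Empty using (⊥-elim)
import Data.Integer as ℤ
import Data.Integer.Properties as ℤ
open import Data.List using (List; []; _∷_; _++_; length; map; concatMap; foldr; deduplicate)
import Data.List.Properties as List
open import Data.List.Membership.Propositional using (_∈_; _∉_; find)
open import Data.List.Membership.Propositional.Properties
  using (∈-map⁻; ∈-concatMap⁻; ∈-filter⁻; ∈-filter⁺; ∈-deduplicate⁺)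
open import Data.List.Relation.Unary.All as All using (All; []; _∷_)
import Data.List.Relation.Unary.All.Properties as All
open import Data.List.Relation.Unary.Any using (here; there)
open import Data.List.Relation.Unary.Unique.Propositional using (Unique; []; _∷_)
import Data.List.Relation.Unary.Unique.Propositional.Properties as Unique
import Data.List.Relation.Unary.Unique.DecPropositional.Properties as DecUnique
open import Data.List.Relation.Binary.Disjoint.Propositional using (Disjoint)
open import Data.List.Membership.Propositional.Properties.WithK using (unique∧set⇒bag)
open import Data.List.Relation.Binary.BagAndSetEquality using (∼bag⇒↭)
open import Data.List.Relation.Binary.Permutation.Propositional.Properties using (↭-length)
open import Data.Nat using (ℕ; zero; suc; _+_; _*_; _^_; _∸_; _≤_; _<_; _⊔_; _%_; _/_; _≡ᵇ_; z≤n; s≤s)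
import Data.Nat.Properties as ℕ
import Data.Nat.DivMod as ℕ
open import Data.Nat.ListAction using (sum; product)
import Data.Nat.ListAction.Properties as ℕ
open import Data.Parity as ℙ using (Parity; 0ℙ; 1ℙ)
open import Data.Nat.Base using (parity)
import Data.Parity.Properties as ℙ
open import Data.Vec as Vec using (zipWith)
import Data.Vec.Properties as Vec
open import Data.Vec.Relation.Unary.All as VecAll using () renaming ([] to []ᵛ; _∷_ to _∷ᵛ_)
import Data.Vec.Relation.Unary.All.Properties as VecAll
open import Data.Product using (∃₂; _×_; _,_; proj₁; proj₂)
open import Data.Sum using (_⊎_; inj₁; inj₂)
open import Function using (_∘_; _$_; _⇔_; mk⇔; Equivalence)
open import Function.Construct.Symmetry using (⇔-sym)
open import Function.Construct.Composition using (_⇔-∘_)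
open import Relation.Binary.PropositionalEquality
open import Relation.Binary using (Setoid)
import Relation.Binary.Reasoning.Setoid as SetoidReasoning
open import Relation.Nullary using (yes; no; does)
import Data.Nat.Tactic.RingSolver as ℕ-Solver
import Data.Integer.Tactic.RingSolver as ℤ-Solver

private
  variable
    d : ℕ

-- Sums and parities

∑ : {A : Set} → List A → (A → ℕ) → ℕ
∑ xs g = sum (map g xs)

module _ {A : Set} where

  ∑-++ : ∀ (xs ys : List A) g → ∑ (xs ++ ys) g ≡ ∑ xs g + ∑ ys g
  ∑-++ xs ys g = trans (cong sum (List.map-++ g xs ys)) (ℕ.sum-++ (map g xs) (map g ys))

  ∑-cong : ∀ (xs : List A) {g h} → (∀ x → g x ≡ h x) → ∑ xs g ≡ ∑ xs h
  ∑-cong xs g≗h = cong sum (List.map-cong g≗h xs)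

  ∑-const-0 : ∀ (xs : List A) → ∑ xs (λ _ → 0) ≡ 0
  ∑-const-0 []       = refl
  ∑-const-0 (_ ∷ xs) = ∑-const-0 xs

  ∑-+ : ∀ (xs : List A) g h → ∑ xs (λ x → g x + h x) ≡ ∑ xs g + ∑ xs h
  ∑-+ []       g h = refl
  ∑-+ (x ∷ xs) g h = trans (cong ((g x + h x) +_) (∑-+ xs g h)) (interchange (g x) (h x) (∑ xs g) (∑ xs h))
    where
    interchange : ∀ a b c e → (a + b) + (c + e) ≡ (a + c) + (b + e)
    interchange = ℕ-Solver.solve-∀

module _ {A B : Set} where

  ∑-map : ∀ (f : A → B) xs g → ∑ (map f xs) g ≡ ∑ xs (g ∘ f)
  ∑-map f xs g = cong sum (sym (List.map-∘ xs))

  ∑-concatMap : ∀ (f : A → List B) xs g → ∑ (concatMap f xs) g ≡ ∑ xs (λ x → ∑ (f x) g)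
  ∑-concatMap f []       g = refl
  ∑-concatMap f (x ∷ xs) g = trans (∑-++ (f x) (concatMap f xs) g) (cong ((∑ (f x) g) +_) (∑-concatMap f xs g))

  ∑-comm : ∀ (xs : List A) (ys : List B) (f : A → B → ℕ) →
    ∑ xs (λ x → ∑ ys (f x)) ≡ ∑ ys (λ y → ∑ xs (λ x → f x y))
  ∑-comm []       ys f = sym (∑-const-0 ys)
  ∑-comm (x ∷ xs) ys f =
    trans (cong ((∑ ys (f x)) +_) (∑-comm xs ys f)) (sym (∑-+ ys (f x) (λ y → ∑ xs (λ x → f x y))))

parity-∑-cong : ∀ {A : Set} (xs : List A) {g h} → (∀ x → parity (g x) ≡ parity (h x)) →
  parity (∑ xs g) ≡ parity (∑ xs h)
parity-∑-cong []       eq = refl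
parity-∑-cong (x ∷ xs) {g} {h} eq = begin
  parity (g x + ∑ xs g)              ≡⟨ ℙ.+-homo-+ (g x) (∑ xs g) ⟩
  parity (g x) ℙ.+ parity (∑ xs g)   ≡⟨ cong₂ ℙ._+_ (eq x) (parity-∑-cong xs eq) ⟩
  parity (h x) ℙ.+ parity (∑ xs h)   ≡⟨ ℙ.+-homo-+ (h x) (∑ xs h) ⟨
  parity (h x + ∑ xs h)              ∎
  where open ≡-Reasoning

-- Off-diagonal terms of a symmetric double sum cancel in pairs.
parity-∑∑-symmetric : ∀ {A : Set} (xs : List A) (f : A → A → ℕ) → (∀ x y → f x y ≡ f y x) →
  parity (∑ xs (λ x → ∑ xs (f x))) ≡ parity (∑ xs (λ x → f x x))
parity-∑∑-symmetric []       f sym-f = refl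
parity-∑∑-symmetric (x ∷ xs) f sym-f = begin
  parity ((f x x + S) + ∑ xs (λ y → f y x + ∑ xs (f y)))
    ≡⟨ cong (λ t → parity ((f x x + S) + t)) (∑-+ xs (λ y → f y x) (λ y → ∑ xs (f y))) ⟩
  parity ((f x x + S) + (∑ xs (λ y → f y x) + R))
    ≡⟨ cong (λ t → parity ((f x x + S) + (t + R))) (∑-cong xs (λ y → sym-f y x)) ⟩
  parity ((f x x + S) + (S + R))
    ≡⟨ cong parity (regroup (f x x) S R) ⟩
  parity (f x x + ((S + S) + R))
    ≡⟨ ℙ.+-homo-+ (f x x) _ ⟩
  parity (f x x) ℙ.+ parity ((S + S) + R)
    ≡⟨ cong (parity (f x x) ℙ.+_) (ℙ.+-homo-+ (S + S) R) ⟩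
  parity (f x x) ℙ.+ (parity (S + S) ℙ.+ parity R)
    ≡⟨ cong (λ p → parity (f x x) ℙ.+ (p ℙ.+ parity R)) (trans (ℙ.+-homo-+ S S) (ℙ.p+p≡0ℙ (parity S))) ⟩
  parity (f x x) ℙ.+ parity R
    ≡⟨ cong (parity (f x x) ℙ.+_) (parity-∑∑-symmetric xs f sym-f) ⟩
  parity (f x x) ℙ.+ parity (∑ xs (λ y → f y y))
    ≡⟨ ℙ.+-homo-+ (f x x) _ ⟨
  parity (f x x + ∑ xs (λ y → f y y))
    ∎
  where
  open ≡-Reasoning
  S = ∑ xs (f x)
  R = ∑ xs (λ y → ∑ xs (f y))
  regroup : ∀ a s r → (a + s) + (s + r) ≡ a + ((s + s) + r)
  regroup = ℕ-Solver.solve-∀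

-- Cells and multiplicities

_⊖_ : Cell d → Cell d → Cell d
_⊖_ = zipWith ℤ._-_

⊕-comm : (u v : Cell d) → u ⊕ v ≡ v ⊕ u
⊕-comm = Vec.zipWith-comm ℤ.+-comm

⊕-identityʳ : (u : Cell d) → u ⊕ origin d ≡ u
⊕-identityʳ Vec.[]       = refl
⊕-identityʳ (x Vec.∷ u) = cong₂ Vec._∷_ (ℤ.+-identityʳ x) (⊕-identityʳ u)

⊖≡⇒≡⊕ : (u p q : Cell d) → u ⊖ p ≡ q → u ≡ p ⊕ q
⊖≡⇒≡⊕ Vec.[]       Vec.[]       Vec.[]       eq = refl
⊖≡⇒≡⊕ (x Vec.∷ u) (y Vec.∷ p) (z Vec.∷ q) eq =
  cong₂ Vec._∷_ (trans (sym (cancel x y)) (cong (λ t → y ℤ.+ t) (Vec.∷-injectiveˡ eq)))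
                (⊖≡⇒≡⊕ u p q (Vec.∷-injectiveʳ eq))
  where
  cancel : ∀ x y → y ℤ.+ (x ℤ.- y) ≡ x
  cancel = ℤ-Solver.solve-∀

≡⊕⇒⊖≡ : (u p q : Cell d) → u ≡ p ⊕ q → u ⊖ p ≡ q
≡⊕⇒⊖≡ Vec.[]       Vec.[]       Vec.[]       eq = refl
≡⊕⇒⊖≡ (x Vec.∷ u) (y Vec.∷ p) (z Vec.∷ q) eq =
  cong₂ Vec._∷_ (trans (cong (ℤ._- y) (Vec.∷-injectiveˡ eq)) (cancel y z))
                (≡⊕⇒⊖≡ u p q (Vec.∷-injectiveʳ eq))
  where
  cancel : ∀ y z → (y ℤ.+ z) ℤ.- y ≡ z
  cancel = ℤ-Solver.solve-∀

⊖-⊕ : (u p q : Cell d) → u ⊖ (p ⊕ q) ≡ (u ⊖ p) ⊖ q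
⊖-⊕ Vec.[]       Vec.[]       Vec.[]       = refl
⊖-⊕ (x Vec.∷ u) (y Vec.∷ p) (z Vec.∷ q) = cong₂ Vec._∷_ (sub-+ x y z) (⊖-⊕ u p q)
  where
  sub-+ : ∀ x y z → x ℤ.- (y ℤ.+ z) ≡ (x ℤ.- y) ℤ.- z
  sub-+ = ℤ-Solver.solve-∀

⊕-cancelˡ : (p : Cell d) {q q′ : Cell d} → p ⊕ q ≡ p ⊕ q′ → q ≡ q′
⊕-cancelˡ p {q} {q′} eq = trans (sym (≡⊕⇒⊖≡ (p ⊕ q) p q refl)) (≡⊕⇒⊖≡ (p ⊕ q) p q′ eq)

δ : Cell d → Cell d → ℕ
δ u v = if does (u ≟c v) then 1 else 0

δ-refl : (u : Cell d) → δ u u ≡ 1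
δ-refl u with u ≟c u
... | yes _  = refl
... | no u≢u = ⊥-elim (u≢u refl)

δ-≢ : {u v : Cell d} → u ≢ v → δ u v ≡ 0
δ-≢ {u = u} {v} u≢v with u ≟c v
... | yes u≡v = ⊥-elim (u≢v u≡v)
... | no _    = refl

δ-translate : (u p q : Cell d) → δ u (p ⊕ q) ≡ δ (u ⊖ p) q
δ-translate u p q with u ≟c (p ⊕ q) | (u ⊖ p) ≟c q
... | yes _ | yes _ = refl
... | yes e | no ne = ⊥-elim (ne (≡⊕⇒⊖≡ u p q e))
... | no ne | yes e = ⊥-elim (ne (⊖≡⇒≡⊕ u p q e))
... | no _  | no _  = refl

mult-∷ : (u v : Cell d) (P : Poly d) → mult u (v ∷ P) ≡ δ u v + mult u P
mult-∷ u v P with does (u ≟c v)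
... | true  = refl
... | false = refl

mult≡∑δ : (u : Cell d) (P : Poly d) → mult u P ≡ ∑ P (δ u)
mult≡∑δ u []      = refl
mult≡∑δ u (v ∷ P) = trans (mult-∷ u v P) (cong ((δ u v) +_) (mult≡∑δ u P))

mult-pos⇒∈ : (u : Cell d) (P : Poly d) → 0 < mult u P → u ∈ P
mult-pos⇒∈ u (v ∷ P) pos with u ≟c v
... | yes refl = here refl
... | no _     = there (mult-pos⇒∈ u P pos)

∉⇒mult≡0 : {u : Cell d} (P : Poly d) → u ∉ P → mult u P ≡ 0
∉⇒mult≡0 {u = u} P u∉P with mult u P in eq
... | zero  = refl
... | suc _ = ⊥-elim (u∉P (mult-pos⇒∈ u P (subst (0 <_) (sym eq) (s≤s z≤n))))

Unique⇒mult≡1 : {u : Cell d} {P : Poly d} → Unique P → u ∈ P → mult u P ≡ 1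
Unique⇒mult≡1 {u = u} {v ∷ P} uniq (here refl) = begin
  mult u (u ∷ P)     ≡⟨ mult-∷ u u P ⟩
  δ u u + mult u P   ≡⟨ cong₂ _+_ (δ-refl u) (∉⇒mult≡0 P (Unique.Unique[x∷xs]⇒x∉xs uniq)) ⟩
  1                  ∎
  where open ≡-Reasoning
Unique⇒mult≡1 {u = u} {v ∷ P} (v≢P ∷ uniq) (there u∈P) = begin
  mult u (v ∷ P)     ≡⟨ mult-∷ u v P ⟩
  δ u v + mult u P   ≡⟨ cong₂ _+_ (δ-≢ (≢-sym (All.lookup v≢P u∈P))) (Unique⇒mult≡1 uniq u∈P) ⟩
  1                  ∎
  where open ≡-Reasoning

odd-mult⇒∈ : (u : Cell d) (P : Poly d) → parity (mult u P) ≡ 1ℙ → u ∈ P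
odd-mult⇒∈ u P odd with mult u P in eq
... | suc _ = mult-pos⇒∈ u P (subst (0 <_) (sym eq) (s≤s z≤n))

∈⇔odd-mult : {u : Cell d} {P : Poly d} → Unique P → u ∈ P ⇔ parity (mult u P) ≡ 1ℙ
∈⇔odd-mult {u = u} {P} uniq = mk⇔ (λ u∈P → cong parity (Unique⇒mult≡1 uniq u∈P)) (odd-mult⇒∈ u P)

length-unique-setEq : {A : Set} {xs ys : List A} → Unique xs → Unique ys →
  (∀ {x} → x ∈ xs ⇔ x ∈ ys) → length xs ≡ length ys
length-unique-setEq uniq-xs uniq-ys xs∼ys = ↭-length (∼bag⇒↭ (unique∧set⇒bag uniq-xs uniq-ys xs∼ys))

-- Multiplication in R

infixl 8 _^⋆_
infixl 7 _⋆_
infix 4 _≈_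

_⋆_ : Poly d → Poly d → Poly d
P ⋆ Q = concatMap (λ p → map (λ q → p ⊕ q) Q) P

record _≈_ (P Q : Poly d) : Set where
  constructor mk≈
  field
    parity-mult : ∀ u → parity (mult u P) ≡ parity (mult u Q)

open _≈_

≈-refl : {P : Poly d} → P ≈ P
≈-refl = mk≈ λ u → refl

≈-sym : {P Q : Poly d} → P ≈ Q → Q ≈ P
≈-sym P≈Q = mk≈ λ u → sym (parity-mult P≈Q u)

≈-trans : {P Q R : Poly d} → P ≈ Q → Q ≈ R → P ≈ R
≈-trans P≈Q Q≈R = mk≈ λ u → trans (parity-mult P≈Q u) (parity-mult Q≈R u)

≈-setoid : ℕ → Setoid _ _
≈-setoid d = record
  { Carrier       = Poly d
  ; _≈_           = _≈_
  ; isEquivalence = record { refl = ≈-refl ; sym = ≈-sym ; trans = ≈-trans }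
  }

∑δ-translate : (u p : Cell d) (Q : Poly d) → ∑ Q (λ q → δ u (p ⊕ q)) ≡ mult (u ⊖ p) Q
∑δ-translate u p Q = trans (∑-cong Q (δ-translate u p)) (sym (mult≡∑δ (u ⊖ p) Q))

mult-⋆ : (u : Cell d) (P Q : Poly d) → mult u (P ⋆ Q) ≡ ∑ P (λ p → ∑ Q (λ q → δ u (p ⊕ q)))
mult-⋆ u P Q = begin
  mult u (P ⋆ Q)                              ≡⟨ mult≡∑δ u (P ⋆ Q) ⟩
  ∑ (P ⋆ Q) (δ u)                             ≡⟨ ∑-concatMap (λ p → map (p ⊕_) Q) P (δ u) ⟩
  ∑ P (λ p → ∑ (map (p ⊕_) Q) (δ u))          ≡⟨ ∑-cong P (λ p → ∑-map (p ⊕_) Q (δ u)) ⟩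
  ∑ P (λ p → ∑ Q (λ q → δ u (p ⊕ q)))         ∎
  where open ≡-Reasoning

mult-⋆ˡ : (u : Cell d) (P Q : Poly d) → mult u (P ⋆ Q) ≡ ∑ P (λ p → mult (u ⊖ p) Q)
mult-⋆ˡ u P Q = trans (mult-⋆ u P Q) (∑-cong P (λ p → ∑δ-translate u p Q))

mult-⋆ʳ : (u : Cell d) (P Q : Poly d) → mult u (P ⋆ Q) ≡ ∑ Q (λ q → mult (u ⊖ q) P)
mult-⋆ʳ u P Q = begin
  mult u (P ⋆ Q)
    ≡⟨ mult-⋆ u P Q ⟩
  ∑ P (λ p → ∑ Q (λ q → δ u (p ⊕ q)))
    ≡⟨ ∑-comm P Q (λ p q → δ u (p ⊕ q)) ⟩
  ∑ Q (λ q → ∑ P (λ p → δ u (p ⊕ q)))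
    ≡⟨ ∑-cong Q (λ q → ∑-cong P (λ p → cong (δ u) (⊕-comm p q))) ⟩
  ∑ Q (λ q → ∑ P (λ p → δ u (q ⊕ p)))
    ≡⟨ ∑-cong Q (λ q → ∑δ-translate u q P) ⟩
  ∑ Q (λ q → mult (u ⊖ q) P)
    ∎
  where open ≡-Reasoning

⋆-congˡ : {P P′ : Poly d} (Q : Poly d) → P ≈ P′ → P ⋆ Q ≈ P′ ⋆ Q
⋆-congˡ {P = P} {P′} Q P≈P′ = mk≈ λ u → begin
  parity (mult u (P ⋆ Q))                ≡⟨ cong parity (mult-⋆ʳ u P Q) ⟩
  parity (∑ Q (λ q → mult (u ⊖ q) P))    ≡⟨ parity-∑-cong Q (λ q → parity-mult P≈P′ (u ⊖ q)) ⟩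
  parity (∑ Q (λ q → mult (u ⊖ q) P′))   ≡⟨ cong parity (mult-⋆ʳ u P′ Q) ⟨
  parity (mult u (P′ ⋆ Q))               ∎
  where open ≡-Reasoning

⋆-congʳ : (P : Poly d) {Q Q′ : Poly d} → Q ≈ Q′ → P ⋆ Q ≈ P ⋆ Q′
⋆-congʳ P {Q} {Q′} Q≈Q′ = mk≈ λ u → begin
  parity (mult u (P ⋆ Q))                ≡⟨ cong parity (mult-⋆ˡ u P Q) ⟩
  parity (∑ P (λ p → mult (u ⊖ p) Q))    ≡⟨ parity-∑-cong P (λ p → parity-mult Q≈Q′ (u ⊖ p)) ⟩
  parity (∑ P (λ p → mult (u ⊖ p) Q′))   ≡⟨ cong parity (mult-⋆ˡ u P Q′) ⟨
  parity (mult u (P ⋆ Q′))               ∎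
  where open ≡-Reasoning

⋆-assoc : (P Q R : Poly d) → (P ⋆ Q) ⋆ R ≈ P ⋆ (Q ⋆ R)
⋆-assoc P Q R = mk≈ λ u → cong parity $ begin
  mult u ((P ⋆ Q) ⋆ R)
    ≡⟨ mult-⋆ˡ u (P ⋆ Q) R ⟩
  ∑ (P ⋆ Q) (λ x → mult (u ⊖ x) R)
    ≡⟨ ∑-concatMap (λ p → map (p ⊕_) Q) P _ ⟩
  ∑ P (λ p → ∑ (map (p ⊕_) Q) (λ x → mult (u ⊖ x) R))
    ≡⟨ ∑-cong P (λ p → ∑-map (p ⊕_) Q _) ⟩
  ∑ P (λ p → ∑ Q (λ q → mult (u ⊖ (p ⊕ q)) R))
    ≡⟨ ∑-cong P (λ p → ∑-cong Q (λ q → cong (λ v → mult v R) (⊖-⊕ u p q))) ⟩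
  ∑ P (λ p → ∑ Q (λ q → mult ((u ⊖ p) ⊖ q) R))
    ≡⟨ ∑-cong P (λ p → mult-⋆ˡ (u ⊖ p) Q R) ⟨
  ∑ P (λ p → mult (u ⊖ p) (Q ⋆ R))
    ≡⟨ mult-⋆ˡ u P (Q ⋆ R) ⟨
  mult u (P ⋆ (Q ⋆ R))
    ∎
  where open ≡-Reasoning

⋆-identityʳ : (P : Poly d) → P ⋆ (origin d ∷ []) ≈ P
⋆-identityʳ {d} P = mk≈ λ u → cong parity $ begin
  mult u (P ⋆ (origin d ∷ []))
    ≡⟨ mult-⋆ u P (origin d ∷ []) ⟩
  ∑ P (λ p → δ u (p ⊕ origin d) + 0)
    ≡⟨ ∑-cong P (λ p → trans (ℕ.+-identityʳ _) (cong (δ u) (⊕-identityʳ p))) ⟩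
  ∑ P (δ u)
    ≡⟨ mult≡∑δ u P ⟨
  mult u P
    ∎
  where open ≡-Reasoning

⋆-self : (P : Poly d) → P ⋆ P ≈ map (λ v → v ⊕ v) P
⋆-self P = mk≈ λ u → begin
  parity (mult u (P ⋆ P))
    ≡⟨ cong parity (mult-⋆ u P P) ⟩
  parity (∑ P (λ p → ∑ P (λ q → δ u (p ⊕ q))))
    ≡⟨ parity-∑∑-symmetric P (λ p q → δ u (p ⊕ q)) (λ p q → cong (δ u) (⊕-comm p q)) ⟩
  parity (∑ P (λ p → δ u (p ⊕ p)))
    ≡⟨ cong parity (∑-map (λ v → v ⊕ v) P (δ u)) ⟨
  parity (∑ (map (λ v → v ⊕ v) P) (δ u))
    ≡⟨ cong parity (mult≡∑δ u (map (λ v → v ⊕ v) P)) ⟨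
  parity (mult u (map (λ v → v ⊕ v) P))
    ∎
  where open ≡-Reasoning

_^⋆_ : Poly d → ℕ → Poly d
_^⋆_ {d} P zero = origin d ∷ []
P ^⋆ suc n      = P ^⋆ n ⋆ P

^⋆-+ : (P : Poly d) (m n : ℕ) → P ^⋆ (m + n) ≈ P ^⋆ m ⋆ P ^⋆ n
^⋆-+ {d} P m zero = begin
  P ^⋆ (m + 0)                  ≡⟨ cong (P ^⋆_) (ℕ.+-identityʳ m) ⟩
  P ^⋆ m                        ≈⟨ ⋆-identityʳ (P ^⋆ m) ⟨
  P ^⋆ m ⋆ (origin d ∷ [])      ∎
  where open SetoidReasoning (≈-setoid d)
^⋆-+ {d} P m (suc n) = begin
  P ^⋆ (m + suc n)              ≡⟨ cong (P ^⋆_) (ℕ.+-suc m n) ⟩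
  P ^⋆ (m + n) ⋆ P              ≈⟨ ⋆-congˡ P (^⋆-+ P m n) ⟩
  P ^⋆ m ⋆ P ^⋆ n ⋆ P           ≈⟨ ⋆-assoc (P ^⋆ m) (P ^⋆ n) P ⟩
  P ^⋆ m ⋆ (P ^⋆ n ⋆ P)         ∎
  where open SetoidReasoning (≈-setoid d)

-- Reduction mod 2

n%2≡ᵇ1⇔odd : ∀ n → T (n % 2 ≡ᵇ 1) ⇔ parity n ≡ 1ℙ
n%2≡ᵇ1⇔odd 0             = mk⇔ (λ ()) (λ ())
n%2≡ᵇ1⇔odd 1             = mk⇔ (λ _ → refl) (λ _ → tt)
n%2≡ᵇ1⇔odd (suc (suc n)) = n%2≡ᵇ1⇔odd n

≡1ℙ⇔⇒≡ : {p q : Parity} → (p ≡ 1ℙ ⇔ q ≡ 1ℙ) → p ≡ q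
≡1ℙ⇔⇒≡ {0ℙ} {0ℙ} _   = refl
≡1ℙ⇔⇒≡ {0ℙ} {1ℙ} p⇔q = Equivalence.from p⇔q refl
≡1ℙ⇔⇒≡ {1ℙ} {0ℙ} p⇔q = sym (Equivalence.to p⇔q refl)
≡1ℙ⇔⇒≡ {1ℙ} {1ℙ} _   = refl

monomials-unique : (P : Poly d) → Unique (monomials P)
monomials-unique P = Unique.filter⁺ _ (DecUnique.deduplicate-! _≟c_ P)

∈-monomials⇔ : {u : Cell d} (P : Poly d) → u ∈ monomials P ⇔ parity (mult u P) ≡ 1ℙ
∈-monomials⇔ {d} {u} P = mk⇔ to from
  where
  odd? : Cell d → Bool
  odd? w = mult w P % 2 ≡ᵇ 1
  to : u ∈ monomials P → parity (mult u P) ≡ 1ℙ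
  to u∈ = Equivalence.to (n%2≡ᵇ1⇔odd (mult u P)) (proj₂ (∈-filter⁻ (T? ∘ odd?) {xs = deduplicate _≟c_ P} u∈))
  from : parity (mult u P) ≡ 1ℙ → u ∈ monomials P
  from odd = ∈-filter⁺ (T? ∘ odd?) (∈-deduplicate⁺ _≟c_ (odd-mult⇒∈ u P odd))
    (Equivalence.from (n%2≡ᵇ1⇔odd (mult u P)) odd)

monomials-≈ : (P : Poly d) → monomials P ≈ P
monomials-≈ P = mk≈ λ u → ≡1ℙ⇔⇒≡ (∈-monomials⇔ P ⇔-∘ ⇔-sym (∈⇔odd-mult (monomials-unique P)))

≈⇒length≡ : {P Q : Poly d} → Unique P → Unique Q → P ≈ Q → length P ≡ length Q
≈⇒length≡ uniqP uniqQ P≈Q = length-unique-setEq uniqP uniqQ λ {u} →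
  ⇔-sym (∈⇔odd-mult uniqQ) ⇔-∘ (same-parity (parity-mult P≈Q u) ⇔-∘ ∈⇔odd-mult uniqP)
  where
  same-parity : {p q : Parity} → p ≡ q → p ≡ 1ℙ ⇔ q ≡ 1ℙ
  same-parity refl = mk⇔ (λ h → h) (λ h → h)

-- Products without cancellation

∈-⋆⁻ : {u : Cell d} (P Q : Poly d) → u ∈ P ⋆ Q → ∃₂ λ p q → p ∈ P × q ∈ Q × u ≡ p ⊕ q
∈-⋆⁻ P Q u∈P⋆Q with find (∈-concatMap⁻ (λ p → map (p ⊕_) Q) {xs = P} u∈P⋆Q)
... | p , p∈P , u∈p⊕Q with ∈-map⁻ (p ⊕_) u∈p⊕Q
...   | q , q∈Q , u≡p⊕q = p , q , p∈P , q∈Q , u≡p⊕q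

⋆-unique : {P Q : Poly d} → Unique P → Unique Q →
  (∀ {p p′ q q′} → p ∈ P → p′ ∈ P → q ∈ Q → q′ ∈ Q → p ⊕ q ≡ p′ ⊕ q′ → p ≡ p′) →
  Unique (P ⋆ Q)
⋆-unique {P = []}    _              _     _        = []
⋆-unique {P = p ∷ P} {Q} (p∉P ∷ uniqP) uniqQ separated =
  Unique.++⁺ (Unique.map⁺ (⊕-cancelˡ p) uniqQ) (⋆-unique uniqP uniqQ (λ a b → separated (there a) (there b))) disjoint
  where
  disjoint : Disjoint (map (p ⊕_) Q) (P ⋆ Q)
  disjoint (v∈p⊕Q , v∈P⋆Q) with ∈-map⁻ (p ⊕_) v∈p⊕Q | ∈-⋆⁻ P Q v∈P⋆Q
  ... | q , q∈Q , refl | p′ , q′ , p′∈P , q′∈Q , eq =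
    All.lookup p∉P p′∈P (separated (here refl) (there p′∈P) q∈Q q′∈Q eq)

length-⋆ : (P Q : Poly d) → length (P ⋆ Q) ≡ length P * length Q
length-⋆ []      Q = refl
length-⋆ (p ∷ P) Q = begin
  length (map (p ⊕_) Q ++ P ⋆ Q)           ≡⟨ List.length-++ (map (p ⊕_) Q) ⟩
  length (map (p ⊕_) Q) + length (P ⋆ Q)   ≡⟨ cong₂ _+_ (List.length-map (p ⊕_) Q) (length-⋆ P Q) ⟩
  length Q + length P * length Q           ∎
  where open ≡-Reasoning

-- Dilations and boxes

-- The substitution xᵢ ↦ xᵢ^(2ʲ) on monomials.
dilate : ℕ → Cell d → Cell d
dilate j = Vec.map (λ c → ℤ.+ (2 ^ j) ℤ.* c)

dilate-zero : (v : Cell d) → dilate 0 v ≡ v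
dilate-zero v = trans (Vec.map-cong ℤ.*-identityˡ v) (Vec.map-id v)

dilate-suc : (j : ℕ) (v : Cell d) → dilate j v ⊕ dilate j v ≡ dilate (suc j) v
dilate-suc j Vec.[]       = refl
dilate-suc j (x Vec.∷ v) = cong₂ Vec._∷_ (double (2 ^ j) x) (dilate-suc j v)
  where
  twice : ∀ b x → b ℤ.* x ℤ.+ b ℤ.* x ≡ (ℤ.+ 2 ℤ.* b) ℤ.* x
  twice = ℤ-Solver.solve-∀
  double : ∀ a x → ℤ.+ a ℤ.* x ℤ.+ ℤ.+ a ℤ.* x ≡ ℤ.+ (2 * a) ℤ.* x
  double a x = trans (twice (ℤ.+ a) x) (cong (ℤ._* x) (sym (ℤ.pos-* 2 a)))

Box : ℕ → Cell d → Set
Box r = VecAll.All (λ c → ℤ.∣ c ∣ ≤ r)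

Box-origin : ∀ d → Box 0 (origin d)
Box-origin zero    = []ᵛ
Box-origin (suc d) = z≤n ∷ᵛ Box-origin d

Box-⊕ : ∀ {r s} {u v : Cell d} → Box r u → Box s v → Box (r + s) (u ⊕ v)
Box-⊕ []ᵛ          []ᵛ          = []ᵛ
Box-⊕ {u = x Vec.∷ _} {y Vec.∷ _} (x≤r ∷ᵛ u≤r) (y≤s ∷ᵛ v≤s) =
  ℕ.≤-trans (ℤ.∣i+j∣≤∣i∣+∣j∣ x y) (ℕ.+-mono-≤ x≤r y≤s) ∷ᵛ Box-⊕ u≤r v≤s

+-*-unique : ∀ M {x x′ y y′} → ℤ.∣ x ∣ + ℤ.∣ x′ ∣ < M →
  x ℤ.+ ℤ.+ M ℤ.* y ≡ x′ ℤ.+ ℤ.+ M ℤ.* y′ → x ≡ x′ × y ≡ y′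
+-*-unique M {x} {x′} {y} {y′} small eq = ℤ.i-j≡0⇒i≡j x x′ x-x′≡0 , sym (ℤ.i-j≡0⇒i≡j y′ y y′-y≡0)
  where
  shift : ∀ x x′ y y′ M → x ℤ.- x′ ≡ (x ℤ.+ M ℤ.* y) ℤ.- (x′ ℤ.+ M ℤ.* y) 
  shift = ℤ-Solver.solve-∀
  collect : ∀ x′ y y′ M → (x′ ℤ.+ M ℤ.* y′) ℤ.- (x′ ℤ.+ M ℤ.* y) ≡ M ℤ.* (y′ ℤ.- y)
  collect = ℤ-Solver.solve-∀
  difference : x ℤ.- x′ ≡ ℤ.+ M ℤ.* (y′ ℤ.- y)
  difference = trans (shift x x′ y y′ (ℤ.+ M))
    (trans (cong (ℤ._- (x′ ℤ.+ ℤ.+ M ℤ.* y)) eq) (collect x′ y y′ (ℤ.+ M)))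
  |difference| : ℤ.∣ x ℤ.- x′ ∣ ≡ M * ℤ.∣ y′ ℤ.- y ∣
  |difference| = trans (cong ℤ.∣_∣ difference) (ℤ.abs-* (ℤ.+ M) (y′ ℤ.- y))
  |difference|<M : M * ℤ.∣ y′ ℤ.- y ∣ < M
  |difference|<M = subst (_< M) |difference| (ℕ.≤-<-trans (ℤ.∣i-j∣≤∣i∣+∣j∣ x x′) small)
  |y′-y|≡0 : ℤ.∣ y′ ℤ.- y ∣ ≡ 0
  |y′-y|≡0 with ℤ.∣ y′ ℤ.- y ∣ | |difference|<M
  ... | zero  | _     = refl
  ... | suc n | M*n<M = ⊥-elim (ℕ.<⇒≱ M*n<M (ℕ.m≤m*n M (suc n)))
  y′-y≡0 : y′ ℤ.- y ≡ ℤ.+ 0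
  y′-y≡0 = ℤ.∣i∣≡0⇒i≡0 |y′-y|≡0
  x-x′≡0 : x ℤ.- x′ ≡ ℤ.+ 0
  x-x′≡0 = trans difference (trans (cong (ℤ.+ M ℤ.*_) y′-y≡0) (ℤ.*-zeroʳ (ℤ.+ M)))

⊕-dilate-unique : ∀ {r} j {a a′ b b′ : Cell d} → r + r < 2 ^ j → Box r a → Box r a′ →
  a ⊕ dilate j b ≡ a′ ⊕ dilate j b′ → a ≡ a′ × b ≡ b′
⊕-dilate-unique j {Vec.[]} {Vec.[]} {Vec.[]} {Vec.[]} _ _ _ _ = refl , refl
⊕-dilate-unique j {x Vec.∷ a} {x′ Vec.∷ a′} {y Vec.∷ b} {y′ Vec.∷ b′}
                  small (x≤r ∷ᵛ a≤r) (x′≤r ∷ᵛ a′≤r) eq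
  with +-*-unique (2 ^ j) {x} {x′} {y} {y′} (ℕ.≤-<-trans (ℕ.+-mono-≤ x≤r x′≤r) small) (Vec.∷-injectiveˡ eq)
     | ⊕-dilate-unique j {b = b} {b′} small a≤r a′≤r (Vec.∷-injectiveʳ eq)
... | refl , refl | refl , refl = refl , refl

dilate-injective : ∀ j {b b′ : Cell d} → dilate j b ≡ dilate j b′ → b ≡ b′
dilate-injective {d} j {b} {b′} eq =
  proj₂ (⊕-dilate-unique j {b = b} {b′} (ℕ.m^n>0 2 j) (Box-origin d) (Box-origin d) origin⊕eq)
  where
  origin⊕eq : origin d ⊕ dilate j b ≡ origin d ⊕ dilate j b′
  origin⊕eq = cong (origin d ⊕_) eq

Box-⋆ : ∀ {r s} {P Q : Poly d} → All (Box r) P → All (Box s) Q → All (Box (r + s)) (P ⋆ Q)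
Box-⋆ []             Q⊆Box = []
Box-⋆ (p∈Box ∷ P⊆Box) Q⊆Box =
  All.++⁺ (All.map⁺ (All.map (Box-⊕ p∈Box) Q⊆Box)) (Box-⋆ P⊆Box Q⊆Box)

Box-^⋆ : ∀ {r} {P : Poly d} → All (Box r) P → ∀ n → All (Box (n * r)) (P ^⋆ n)
Box-^⋆ {d} P⊆Box zero    = Box-origin d ∷ []
Box-^⋆ {r = r} {P} P⊆Box (suc n) =
  subst (λ s → All (Box s) (P ^⋆ suc n)) (ℕ.+-comm (n * r) r) (Box-⋆ (Box-^⋆ P⊆Box n) P⊆Box)

^⋆-2^* : (P Q : Poly d) (m : ℕ) → P ^⋆ m ≈ Q → ∀ j → P ^⋆ (2 ^ j * m) ≈ map (dilate j) Q
^⋆-2^* {d} P Q m Pᵐ≈Q zero = begin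
  P ^⋆ (1 * m)              ≡⟨ cong (P ^⋆_) (ℕ.*-identityˡ m) ⟩
  P ^⋆ m                    ≈⟨ Pᵐ≈Q ⟩
  Q                         ≡⟨ trans (List.map-cong dilate-zero Q) (List.map-id Q) ⟨
  map (dilate 0) Q          ∎
  where open SetoidReasoning (≈-setoid d)
^⋆-2^* {d} P Q m Pᵐ≈Q (suc j) = begin
  P ^⋆ (2 ^ suc j * m)                           ≡⟨ cong (P ^⋆_) (double-* (2 ^ j) m) ⟩
  P ^⋆ (2 ^ j * m + 2 ^ j * m)                   ≈⟨ ^⋆-+ P (2 ^ j * m) (2 ^ j * m) ⟩
  P ^⋆ (2 ^ j * m) ⋆ P ^⋆ (2 ^ j * m)            ≈⟨ ⋆-congˡ (P ^⋆ (2 ^ j * m)) IH ⟩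
  map (dilate j) Q ⋆ P ^⋆ (2 ^ j * m)            ≈⟨ ⋆-congʳ (map (dilate j) Q) IH ⟩
  map (dilate j) Q ⋆ map (dilate j) Q            ≈⟨ ⋆-self (map (dilate j) Q) ⟩
  map (λ v → v ⊕ v) (map (dilate j) Q)           ≡⟨ List.map-∘ Q ⟨
  map (λ v → dilate j v ⊕ dilate j v) Q          ≡⟨ List.map-cong (dilate-suc j) Q ⟩
  map (dilate (suc j)) Q                         ∎
  where
  open SetoidReasoning (≈-setoid d)
  IH = ^⋆-2^* P Q m Pᵐ≈Q j
  double-* : ∀ x m → (2 * x) * m ≡ x * m + x * m
  double-* = ℕ-Solver.solve-∀

foldr-⊔≤⇒All≤ : ∀ {A : Set} {r} (f : A → ℕ) (xs : List A) →
  foldr (λ x m → f x ⊔ m) 0 xs ≤ r → All (λ x → f x ≤ r) xs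
foldr-⊔≤⇒All≤ f []       _ = []
foldr-⊔≤⇒All≤ f (x ∷ xs) h = ℕ.m⊔n≤o⇒m≤o (f x) _ h ∷ foldr-⊔≤⇒All≤ f xs (ℕ.m⊔n≤o⇒n≤o (f x) _ h)

height≤⇒Box : ∀ {r} (P : Poly d) → height P ≤ r → All (Box r) (monomials P)
height≤⇒Box P h =
  All.map (λ {e} e≤r → VecAll.toList⁻ (foldr-⊔≤⇒All≤ ℤ.∣_∣ (Vec.toList e) e≤r))
          (foldr-⊔≤⇒All≤ _ (monomials P) h)

pred+pred<double : ∀ n → 0 < n → (n ∸ 1) + (n ∸ 1) < 2 * n
pred+pred<double (suc p) _ = subst (p + p <_) (sym (double-suc p)) (s≤s (ℕ.n≤1+n (p + p)))
  where
  double-suc : ∀ p → 2 * suc p ≡ suc (suc (p + p))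
  double-suc = ℕ-Solver.solve-∀

-- The odd-rule automaton

module _ {d : ℕ} (F : Poly d) where

  private
    G = generation F
    F̂ = monomials F

  generation-unique : ∀ n → Unique (G n)
  generation-unique zero    = [] ∷ []
  generation-unique (suc n) = monomials-unique (G n ⋆ F̂)

  generation-≈ : ∀ n → G n ≈ F̂ ^⋆ n
  generation-≈ zero    = ≈-refl
  generation-≈ (suc n) = begin
    monomials (G n ⋆ F̂)   ≈⟨ monomials-≈ (G n ⋆ F̂) ⟩
    G n ⋆ F̂               ≈⟨ ⋆-congˡ F̂ (generation-≈ n) ⟩
    F̂ ^⋆ n ⋆ F̂            ∎
    where open SetoidReasoning (≈-setoid d)

  generation-⊆-Box : height F ≤ 1 → ∀ n {u} → u ∈ G n → Box n u
  generation-⊆-Box height≤1 n {u} u∈Gn =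
    subst (λ r → Box r u) (ℕ.*-identityʳ n) (All.lookup (Box-^⋆ (height≤⇒Box F height≤1) n) u∈F̂ⁿ)
    where
    u∈F̂ⁿ : u ∈ F̂ ^⋆ n
    u∈F̂ⁿ = odd-mult⇒∈ u (F̂ ^⋆ n)
      (trans (sym (parity-mult (generation-≈ n) u)) (Equivalence.to (∈⇔odd-mult (generation-unique n)) u∈Gn))

  generation-+-2^* : ∀ K j m → G (K + 2 ^ j * m) ≈ G K ⋆ map (dilate j) (G m)
  generation-+-2^* K j m = begin
    G (K + 2 ^ j * m)                  ≈⟨ generation-≈ (K + 2 ^ j * m) ⟩
    F̂ ^⋆ (K + 2 ^ j * m)               ≈⟨ ^⋆-+ F̂ K (2 ^ j * m) ⟩
    F̂ ^⋆ K ⋆ F̂ ^⋆ (2 ^ j * m)          ≈⟨ ⋆-congˡ (F̂ ^⋆ (2 ^ j * m)) (≈-sym (generation-≈ K)) ⟩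
    G K ⋆ F̂ ^⋆ (2 ^ j * m)             ≈⟨ ⋆-congʳ (G K) (^⋆-2^* F̂ (G m) m (≈-sym (generation-≈ m)) j) ⟩
    G K ⋆ map (dilate j) (G m)         ∎
    where open SetoidReasoning (≈-setoid d)

  generation-⋆-dilate-unique : height F ≤ 1 → ∀ k m → Unique (G (2 ^ k ∸ 1) ⋆ map (dilate (suc k)) (G m))
  generation-⋆-dilate-unique height≤1 k m =
    ⋆-unique (generation-unique K) (Unique.map⁺ (dilate-injective (suc k)) (generation-unique m)) separated
    where
    K = 2 ^ k ∸ 1
    separated : ∀ {a a′ c c′} → a ∈ G K → a′ ∈ G K → c ∈ map (dilate (suc k)) (G m) →
      c′ ∈ map (dilate (suc k)) (G m) → a ⊕ c ≡ a′ ⊕ c′ → a ≡ a′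
    separated a∈ a′∈ c∈ c′∈ eq with ∈-map⁻ (dilate (suc k)) c∈ | ∈-map⁻ (dilate (suc k)) c′∈
    ... | _ , _ , refl | _ , _ , refl =
      proj₁ (⊕-dilate-unique (suc k) (pred+pred<double (2 ^ k) (ℕ.m^n>0 2 k))
        (generation-⊆-Box height≤1 K a∈) (generation-⊆-Box height≤1 K a′∈) eq)

  a-multiplicative : height F ≤ 1 → ∀ k m → a F ((2 ^ k ∸ 1) + 2 ^ suc k * m) ≡ a F (2 ^ k ∸ 1) * a F m
  a-multiplicative height≤1 k m = begin
    length (G (K + 2 ^ suc k * m))
      ≡⟨ ≈⇒length≡ (generation-unique (K + 2 ^ suc k * m)) (generation-⋆-dilate-unique height≤1 k m)
                   (generation-+-2^* K (suc k) m) ⟩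
    length (G K ⋆ C)
      ≡⟨ length-⋆ (G K) C ⟩
    length (G K) * length C
      ≡⟨ cong (length (G K) *_) (List.length-map (dilate (suc k)) (G m)) ⟩
    length (G K) * length (G m)
      ∎
    where
    open ≡-Reasoning
    K = 2 ^ k ∸ 1
    C = map (dilate (suc k)) (G m)

-- Run length transforms

binary-digit : ∀ n → ((n % 2 ≡ᵇ 1) ≡ false × n ≡ 2 * (n / 2))
                   ⊎ ((n % 2 ≡ᵇ 1) ≡ true  × n ≡ suc (2 * (n / 2)))
binary-digit n with n % 2 | ℕ.m%n<n n 2 | ℕ.m≡m%n+[m/n]*n n 2
... | 0 | _ | n≡ = inj₁ (refl , trans n≡ (ℕ.*-comm (n / 2) 2))
... | 1 | _ | n≡ = inj₂ (refl , trans n≡ (cong suc (ℕ.*-comm (n / 2) 2)))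
... | suc (suc _) | s≤s (s≤s ()) | _

module _ (f : ℕ → ℕ) (f0≡1 : f 0 ≡ 1)
         (f-mult : ∀ k m → f ((2 ^ k ∸ 1) + 2 ^ suc k * m) ≡ f (2 ^ k ∸ 1) * f m) where

  private
    S : ℕ → ℕ
    S i = f (2 ^ i ∸ 1)

  product-flush : ∀ acc → product (map S (flush acc)) ≡ f (2 ^ acc ∸ 1)
  product-flush zero      = sym f0≡1
  product-flush (suc acc) = ℕ.*-identityʳ (S (suc acc))

  -- Invariant: acc ones have been read off a number whose remaining binary digits are those of n,
  -- so the number is (2^acc − 1) + 2^acc · n.
  product-runs : ∀ fuel n acc → n ≤ fuel →
    product (map S (runsAux acc (bitsAux fuel n))) ≡ f ((2 ^ acc ∸ 1) + 2 ^ acc * n)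
  product-runs fuel zero acc _ = begin
    product (map S (runsAux acc (bitsAux fuel 0)))  ≡⟨ cong (λ bs → product (map S (runsAux acc bs))) (no-bits fuel) ⟩
    product (map S (flush acc))                     ≡⟨ product-flush acc ⟩
    f (2 ^ acc ∸ 1)                                 ≡⟨ cong f (ℕ.+-identityʳ _) ⟨
    f ((2 ^ acc ∸ 1) + 0)                           ≡⟨ cong (λ t → f ((2 ^ acc ∸ 1) + t)) (ℕ.*-zeroʳ (2 ^ acc)) ⟨
    f ((2 ^ acc ∸ 1) + 2 ^ acc * 0)                 ∎
    where
    open ≡-Reasoning
    no-bits : ∀ fuel → bitsAux fuel 0 ≡ []
    no-bits zero    = refl
    no-bits (suc _) = refl
  product-runs (suc fuel) (suc n) acc (s≤s n≤fuel) with binary-digit (suc n)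
  ... | inj₁ (digit≡0 , n≡2q) = begin
    product (map S (runsAux acc (bitsAux (suc fuel) (suc n))))
      ≡⟨ cong (λ b → product (map S (runsAux acc (b ∷ bitsAux fuel q)))) digit≡0 ⟩
    product (map S (flush acc ++ runsAux 0 (bitsAux fuel q)))
      ≡⟨ cong product (List.map-++ S (flush acc) _) ⟩
    product (map S (flush acc) ++ map S (runsAux 0 (bitsAux fuel q)))
      ≡⟨ ℕ.product-++ (map S (flush acc)) _ ⟩
    product (map S (flush acc)) * product (map S (runsAux 0 (bitsAux fuel q)))
      ≡⟨ cong₂ _*_ (product-flush acc) (product-runs fuel q 0 q≤fuel) ⟩
    f (2 ^ acc ∸ 1) * f (0 + 1 * q)
      ≡⟨ cong (λ t → f (2 ^ acc ∸ 1) * f t) (ℕ.*-identityˡ q) ⟩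
    f (2 ^ acc ∸ 1) * f q
      ≡⟨ f-mult acc q ⟨
    f ((2 ^ acc ∸ 1) + 2 ^ suc acc * q)
      ≡⟨ cong (λ t → f ((2 ^ acc ∸ 1) + t)) (trans (*-reassoc (2 ^ acc) q) (cong (2 ^ acc *_) (sym n≡2q))) ⟩
    f ((2 ^ acc ∸ 1) + 2 ^ acc * suc n)
      ∎
    where
    open ≡-Reasoning
    q = suc n / 2
    q≤fuel = ℕ.≤-trans (ℕ.≤-pred (ℕ.m/n<m (suc n) 2 (s≤s (s≤s z≤n)))) n≤fuel
    *-reassoc : ∀ x q → (2 * x) * q ≡ x * (2 * q)
    *-reassoc = ℕ-Solver.solve-∀
  ... | inj₂ (digit≡1 , n≡2q+1) = begin
    product (map S (runsAux acc (bitsAux (suc fuel) (suc n))))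
      ≡⟨ cong (λ b → product (map S (runsAux acc (b ∷ bitsAux fuel q)))) digit≡1 ⟩
    product (map S (runsAux (suc acc) (bitsAux fuel q)))
      ≡⟨ product-runs fuel q (suc acc) q≤fuel ⟩
    f ((2 ^ suc acc ∸ 1) + 2 ^ suc acc * q)
      ≡⟨ cong f (shift-digit (2 ^ acc) q (ℕ.m^n>0 2 acc)) ⟩
    f ((2 ^ acc ∸ 1) + 2 ^ acc * suc (2 * q))
      ≡⟨ cong (λ t → f ((2 ^ acc ∸ 1) + 2 ^ acc * t)) n≡2q+1 ⟨
    f ((2 ^ acc ∸ 1) + 2 ^ acc * suc n)
      ∎
    where
    open ≡-Reasoning
    q = suc n / 2
    q≤fuel = ℕ.≤-trans (ℕ.≤-pred (ℕ.m/n<m (suc n) 2 (s≤s (s≤s z≤n)))) n≤fuel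
    shift-digit : ∀ P q → 0 < P → (2 * P ∸ 1) + (2 * P) * q ≡ (P ∸ 1) + P * suc (2 * q)
    shift-digit (suc P) q _ = ring P q
      where
      ring : ∀ P q → (P + (suc P + 0)) + (2 * suc P) * q ≡ P + suc P * suc (2 * q)
      ring = ℕ-Solver.solve-∀

  multiplicative⇒runLengthTransform : ∀ n → f n ≡ runLengthTransform S n
  multiplicative⇒runLengthTransform n =
    sym (trans (product-runs n n 0 ℕ.≤-refl) (cong f (ℕ.*-identityˡ n)))

theorem2 : (d : ℕ) → 1 ≤ d → (F : Poly d) → height F ≤ 1 →
    (n : ℕ) → a F n ≡ runLengthTransform (λ i → a F (2 ^ i ∸ 1)) n
theorem2 d _ F height≤1 = multiplicative⇒runLengthTransform (a F) refl (a-multiplicative F height≤1)
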